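{- Let $k\le n$ be positive integers and $w\in\mathcal{W}_{n,k}$. Let $w\circledast 1 \in \mathcal{W}_{n+1,k}$ be the word obtained by appending to the end of $w$ the letter $w_{i_m}$, where $i_m$ is the largest initial position of $w$. Then $\mathfrak{S}_{w\circledast 1} = \mathfrak{S}_w$ as polynomials.
   Context: $\mathcal{W}_{n,k}$ is the set of words $w = w_1\cdots w_n\in[k]^n$ in which each of $1,\dots,k$ appears. A position $j$ is initial in $w$ if $w_{j'}\neq w_j$ for all $j'<j$. Schubert polynomials for words: $\mathfrak{S}_\pi$ for $\pi\in S_N$ is the classical Schubert polynomial ($\mathfrak{S}_{w_0}=x_1^{N-1}\cdots x_{N-1}$, $\mathfrak{S}_{\pi s_i}=\partial_i\mathfrak{S}_\pi$ if $\pi(i)>\pi(i+1)$, where $\partial_i f=(f-s_if)/(x_i-x_{i+1})$). $S_n$ acts on polynomials by $\pi.x_i = x_{\pi(i)}$. For $w\in[k]^n$ with $m$ distinct letters, $\mathrm{std}(w)\in S_{n+k-m}$ keeps letters in initial positions, replaces letters in non-initial positions from left to right by $k+1,\dots,k+n-m$, and appends the letters of $[k]$ missing from $w$ in increasing order. $\mathrm{conv}(w)$ is the unique word with no subword $i\cdots j\cdots i$ ($i\neq j$) having the same letter multiplicities as $w$ and the same left-to-right order of initial letters. If the initial letters of $w$ are $a_1,\dots,a_m$ left to right, $\sigma(w)\in S_n$ has one-line notation listing the positions of the occurrences of $a_1$ in increasing order, then of $a_2$, etc. Then $\mathfrak{S}_w := \sigma(w)^{ -1}.\mathfrak{S}_{\mathrm{std}(\mathrm{conv}(w))}$.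 -}

module Defs where

open import Data.Nat as ℕ using (ℕ; zero; suc; _+_; _∸_; _≤_; _<ᵇ_; _≡ᵇ_)
open import Data.Integer as ℤ using (ℤ)
open import Data.Bool using (Bool; true; false; if_then_else_; not; _∧_)
open import Data.List using (List; []; _∷_; _++_; map; concatMap; replicate; length; filterᵇ; upTo; downFrom; zip; foldr; sum)
open import Data.List.Properties using (≡-dec)
open import Data.List.Relation.Unary.All using (All)
open import Data.List.Membership.Propositional using (_∈_)
import Data.Maybe
open import Data.Maybe using (Maybe; just; nothing)
open import Data.Product using (_×_; _,_; proj₁; proj₂)
open import Relation.Nullary.Decidable using (does)
open import Relation.Binary.PropositionalEquality using (_≡_)

-- Polynomials in ℤ[x₁, x₂, …]
-- A monomial is its exponent list: position 0 is the exponent of x₁,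
-- position 1 that of x₂, etc. (missing trailing entries = exponent 0).
-- A polynomial is a formal (unnormalised) ℤ-linear combination of monomials.

Mono : Set
Mono = List ℕ

Poly : Set
Poly = List (ℤ × Mono)

stripZ : Mono → Mono
stripZ [] = []
stripZ (a ∷ e) with stripZ e
... | [] = if a ≡ᵇ 0 then [] else a ∷ []
... | r  = a ∷ r

monoEq : Mono → Mono → Bool
monoEq e f = does (≡-dec ℕ._≟_ (stripZ e) (stripZ f))

coeff : Poly → Mono → ℤ
coeff [] m = ℤ.0ℤ
coeff ((c , e) ∷ p) m = if monoEq e m then c ℤ.+ coeff p m else coeff p m

infix 4 _≈ₚ_
_≈ₚ_ : Poly → Poly → Set
p ≈ₚ q = ∀ (m : Mono) → coeff p m ≡ coeff q m

pone : Poly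
pone = (ℤ.1ℤ , []) ∷ []

scale : ℤ → Poly → Poly
scale c = map (λ t → (c ℤ.* proj₁ t , proj₂ t))

mmul : Mono → Mono → Mono
mmul [] f = f
mmul e [] = e
mmul (a ∷ e) (b ∷ f) = (a + b) ∷ mmul e f

pmul : Poly → Poly → Poly
pmul p q = concatMap (λ t → map (λ u → (proj₁ t ℤ.* proj₁ u , mmul (proj₂ t) (proj₂ u))) q) p

ppow : Poly → ℕ → Poly
ppow p zero = pone
ppow p (suc n) = pmul p (ppow p n)

-- the variable x_i (i ≥ 1)
var : ℕ → Poly
var i = (ℤ.1ℤ , replicate (i ∸ 1) 0 ++ (1 ∷ [])) ∷ []

substMono : (ℕ → Poly) → ℕ → Mono → Poly
substMono s j [] = pone
substMono s j (a ∷ e) = pmul (ppow (s j) a) (substMono s (suc j) e)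

substPoly : (ℕ → Poly) → Poly → Poly
substPoly s = concatMap (λ t → scale (proj₁ t) (substMono s 1 (proj₂ t)))

-- Permutations in one-line notation (values 1..N) and their action

nth : List ℕ → ℕ → ℕ   -- 0-indexed, default 0
nth [] i = 0
nth (a ∷ l) zero = a
nth (a ∷ l) (suc i) = nth l i

permApp : List ℕ → ℕ → ℕ
permApp π i = if (0 <ᵇ i) ∧ (i ∸ 1 <ᵇ length π) then nth π (i ∸ 1) else i

-- 1-based position of the first occurrence of j in l (0 if absent)
posOf : ℕ → List ℕ → ℕ
posOf j [] = 0
posOf j (a ∷ l) = if a ≡ᵇ j then 1 else (if posOf j l ≡ᵇ 0 then 0 else suc (posOf j l))

oneTo : ℕ → List ℕ
oneTo n = map suc (upTo n)

permInv : List ℕ → List ℕ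
permInv π = map (λ j → posOf j π) (oneTo (length π))

-- π.f where π.x_i = x_{π(i)}
act : List ℕ → Poly → Poly
act π = substPoly (λ i → var (permApp π i))

-- Divided differences ∂_i f = (f - s_i f)/(x_i - x_{i+1}), computed
-- monomial by monomial: for a monomial r·x_i^a x_{i+1}^b (r free of
-- x_i, x_{i+1}), the quotient is
--   a > b :   r · Σ_{j=0}^{a-b-1} x_i^{b+j} x_{i+1}^{a-1-j}
--   a < b : - r · Σ_{j=0}^{b-a-1} x_i^{a+j} x_{i+1}^{b-1-j}
--   a = b :   0

setAt : Mono → ℕ → ℕ → Mono   -- 0-indexed, pads with zeros
setAt [] zero v = v ∷ []
setAt [] (suc p) v = 0 ∷ setAt [] p v
setAt (a ∷ e) zero v = v ∷ e
setAt (a ∷ e) (suc p) v = a ∷ setAt e p v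

ddSum : ℤ → ℕ → ℕ → ℕ → Mono → ℕ → Poly
ddSum c i lo hi r zero = []
ddSum c i lo hi r (suc d) =
  (c , setAt (setAt r (i ∸ 1) (lo + d)) i (hi ∸ 1 ∸ d)) ∷ ddSum c i lo hi r d

ddTerm : ℕ → ℤ × Mono → Poly
ddTerm i (c , e) =
  let a = nth e (i ∸ 1)
      b = nth e i
      r = setAt (setAt e (i ∸ 1) 0) i 0
  in if b <ᵇ a then ddSum c i b a r (a ∸ b)
     else (if a <ᵇ b then ddSum (ℤ.- c) i a b r (b ∸ a) else [])

dd : ℕ → Poly → Poly
dd i = concatMap (ddTerm i)

schubTop : ℕ → Poly
schubTop N = (ℤ.1ℤ , downFrom N) ∷ []

firstAscent : List ℕ → Maybe ℕ
firstAscent [] = nothing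
firstAscent (a ∷ []) = nothing
firstAscent (a ∷ b ∷ l) =
  if a <ᵇ b then just 1 else Data.Maybe.map suc (firstAscent (b ∷ l))

swapAdj : List ℕ → ℕ → List ℕ
swapAdj [] i = []
swapAdj (a ∷ []) i = a ∷ []
swapAdj (a ∷ b ∷ l) zero = a ∷ b ∷ l
swapAdj (a ∷ b ∷ l) (suc zero) = b ∷ a ∷ l
swapAdj (a ∷ b ∷ l) (suc (suc i)) = a ∷ swapAdj (b ∷ l) (suc i)

nonInv : List ℕ → ℕ
nonInv [] = 0
nonInv (a ∷ l) = length (filterᵇ (a <ᵇ_) l) + nonInv l

-- 𝔖_π = ∂_i 𝔖_{π s_i} where i is the first ascent of π; 𝔖_{w₀} at the top.
-- The fuel nonInv π is exactly the length of this chain up to w₀.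
schubAux : ℕ → List ℕ → Poly
schubAux zero π = schubTop (length π)
schubAux (suc f) π with firstAscent π
... | nothing = schubTop (length π)
... | just i = dd i (schubAux f (swapAdj π i))

schub : List ℕ → Poly
schub π = schubAux (nonInv π) π

memb : ℕ → List ℕ → Bool
memb a [] = false
memb a (b ∷ l) = if a ≡ᵇ b then true else memb a l

initLettersAux : List ℕ → List ℕ → List ℕ
initLettersAux seen [] = []
initLettersAux seen (a ∷ w) =
  if memb a seen then initLettersAux seen w else a ∷ initLettersAux (a ∷ seen) w

initLetters : List ℕ → List ℕ
initLetters = initLettersAux []

count : ℕ → List ℕ → ℕ
count a w = length (filterᵇ (a ≡ᵇ_) w)

conv : List ℕ → List ℕ
conv w = concatMap (λ a → replicate (count a w) a) (initLetters w)

stdAux : List ℕ → ℕ → List ℕ → List ℕ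
stdAux seen nxt [] = []
stdAux seen nxt (a ∷ w) =
  if memb a seen then nxt ∷ stdAux seen (suc nxt) w else a ∷ stdAux (a ∷ seen) nxt w

std : ℕ → List ℕ → List ℕ
std k w = stdAux [] (suc k) w ++ filterᵇ (λ a → not (memb a w)) (oneTo k)

positions : ℕ → List ℕ → List ℕ
positions a w = map proj₁ (filterᵇ (λ t → a ≡ᵇ proj₂ t) (zip (oneTo (length w)) w))

sigma : List ℕ → List ℕ
sigma w = concatMap (λ a → positions a w) (initLetters w)

schubWord : ℕ → List ℕ → Poly
schubWord k w = act (permInv (sigma w)) (schub (std k (conv w)))

InW : ℕ → ℕ → List ℕ → Set
InW n k w = (length w ≡ n)
          × All (λ a → 1 ≤ a × a ≤ k) w
          × (∀ a → 1 ≤ a → a ≤ k → a ∈ w)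

lastOr : ℕ → List ℕ → ℕ
lastOr d [] = d
lastOr d (a ∷ l) = lastOr a l

appendLastInit : List ℕ → List ℕ
appendLastInit w = w ++ (lastOr 0 (initLetters w) ∷ [])

-- Appending the last initial letter a of w leaves the initial letters unchanged and only
-- lengthens the last block of conv(w), so conv(w ⊛ 1) = conv(w) a and σ(w ⊛ 1) = σ(w) (n+1).
-- As every letter of [k] already occurs in w, std(conv(w) a) = std(conv(w)) M with M larger
-- than all earlier entries, and σ(w ⊛ 1)⁻¹ is σ(w)⁻¹ extended by the fixed point n+1.
-- Everything thus reduces to the stability 𝔖_{π M} = 𝔖_π of Schubert polynomials: from π M
-- the recursion first performs the ascents of π; once π is decreasing, M bubbles to the front,
-- and ∂_N ⋯ ∂₁ (x₁^N x₂^(N-1) ⋯ x_N) = x₁^(N-1) ⋯ x_(N-1).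
-- Polynomials are compared term by term, up to padding exponent lists with zeros.

module Submission where

open import Defs
open import Data.Nat using (ℕ; zero; suc; _+_; _∸_; _≤_; _<_; _<ᵇ_; _≡ᵇ_; z≤n; s≤s)
import Data.Nat.Properties as ℕP
open import Data.Nat.ListAction using (sum)
open import Data.Nat.Tactic.RingSolver using (solve-∀)
import Data.Integer as ℤ
open import Data.Bool using (Bool; true; false; T; if_then_else_; not)
open import Data.Bool.Properties using (T-≡)
open import Data.Empty using (⊥-elim)
open import Data.Maybe as Maybe using (just; nothing)
open import Data.Sum using (_⊎_; inj₁; inj₂)
open import Data.Product using (_×_; _,_; proj₁; proj₂; ∃-syntax)
open import Data.List
  using (List; []; _∷_; _++_; map; concat; concatMap; replicate; length; filterᵇ; upTo; downFrom; zip)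
import Data.List.Properties as LP
open import Data.List.Membership.Propositional using (_∈_)
open import Data.List.Relation.Binary.Pointwise as PW using (Pointwise; []; _∷_)
open import Data.List.Relation.Unary.All as All using (All; []; _∷_)
import Data.List.Relation.Unary.All.Properties as AP
open import Data.List.Relation.Unary.Any using (here; there)
open import Data.List.Reverse as Reverse using (Reverse; reverseView; _∶_∶ʳ_)
open import Function.Base using (_∘_)
open import Function.Bundles using (Equivalence)
open import Relation.Binary.Definitions using (tri<; tri≈; tri>)
open import Relation.Binary.PropositionalEquality
open import Relation.Nullary.Decidable using (T?)

if-cong : ∀ {A : Set} {b b′} {x y : A} → b ≡ b′ → (if b then x else y) ≡ (if b′ then x else y)
if-cong refl = refl

≡ᵇ-refl : ∀ n → (n ≡ᵇ n) ≡ true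
≡ᵇ-refl n = Equivalence.to T-≡ (ℕP.≡⇒≡ᵇ n n refl)

≡ᵇ-true⇒≡ : ∀ m n → (m ≡ᵇ n) ≡ true → m ≡ n
≡ᵇ-true⇒≡ m n eq = ℕP.≡ᵇ⇒≡ m n (Equivalence.from T-≡ eq)

≢⇒≡ᵇ-false : ∀ m n → m ≢ n → (m ≡ᵇ n) ≡ false
≢⇒≡ᵇ-false m n m≢n with m ≡ᵇ n in eq
... | true = ⊥-elim (m≢n (≡ᵇ-true⇒≡ m n eq))
... | false = refl

≡ᵇ-sym : ∀ m n → (m ≡ᵇ n) ≡ (n ≡ᵇ m)
≡ᵇ-sym zero zero = refl
≡ᵇ-sym zero (suc n) = refl
≡ᵇ-sym (suc m) zero = refl
≡ᵇ-sym (suc m) (suc n) = ≡ᵇ-sym m n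

<⇒<ᵇ-true : ∀ {m n} → m < n → (m <ᵇ n) ≡ true
<⇒<ᵇ-true m<n = Equivalence.to T-≡ (ℕP.<⇒<ᵇ m<n)

≤⇒<ᵇ-false : ∀ {m n} → n ≤ m → (m <ᵇ n) ≡ false
≤⇒<ᵇ-false {m} {n} n≤m with m <ᵇ n in eq
... | true = ⊥-elim (ℕP.<⇒≱ (ℕP.<ᵇ⇒< m n (Equivalence.from T-≡ eq)) n≤m)
... | false = refl

<ᵇ-true⇒< : ∀ m n → (m <ᵇ n) ≡ true → m < n
<ᵇ-true⇒< m n eq = ℕP.<ᵇ⇒< m n (Equivalence.from T-≡ eq)

<ᵇ-false⇒≥ : ∀ m n → (m <ᵇ n) ≡ false → n ≤ m
<ᵇ-false⇒≥ m n eq = ℕP.≮⇒≥ (λ m<n → subst T eq (ℕP.<⇒<ᵇ m<n))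

-- Polynomials up to zero padding of exponent lists

infix 4 _≗ₘ_ _≃ₚ_

record _≗ₘ_ (e f : Mono) : Set where
  constructor mk≗ₘ
  field at : ∀ j → nth e j ≡ nth f j
open _≗ₘ_

_≃ₚ_ : Poly → Poly → Set
_≃ₚ_ = Pointwise (λ t u → proj₁ t ≡ proj₁ u × proj₂ t ≗ₘ proj₂ u)

≃ₚ-refl : ∀ {p} → p ≃ₚ p
≃ₚ-refl = PW.refl (refl , mk≗ₘ λ _ → refl)

≃ₚ-trans : ∀ {p q r} → p ≃ₚ q → q ≃ₚ r → p ≃ₚ r
≃ₚ-trans = PW.transitive λ (c≡ , e≗) (c≡′ , e≗′) →
  trans c≡ c≡′ , mk≗ₘ λ j → trans (at e≗ j) (at e≗′ j)

nth-setAt : ∀ e p v q → nth (setAt e p v) q ≡ (if q ≡ᵇ p then v else nth e q)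
nth-setAt [] zero v zero = refl
nth-setAt [] zero v (suc q) = refl
nth-setAt [] (suc p) v zero = refl
nth-setAt [] (suc p) v (suc q) = nth-setAt [] p v q
nth-setAt (a ∷ e) zero v zero = refl
nth-setAt (a ∷ e) zero v (suc q) = refl
nth-setAt (a ∷ e) (suc p) v zero = refl
nth-setAt (a ∷ e) (suc p) v (suc q) = nth-setAt e p v q

setAt-cong : ∀ {e f} p v → e ≗ₘ f → setAt e p v ≗ₘ setAt f p v
setAt-cong {e} {f} p v e≗f = mk≗ₘ λ q → pointwise q
  where
  pointwise : ∀ q → nth (setAt e p v) q ≡ nth (setAt f p v) q
  pointwise q rewrite nth-setAt e p v q | nth-setAt f p v q with q ≡ᵇ p
  ... | true = refl
  ... | false = at e≗f q

ddSum-cong : ∀ c i lo hi {r r′} d → r ≗ₘ r′ → ddSum c i lo hi r d ≃ₚ ddSum c i lo hi r′ d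
ddSum-cong c i lo hi zero r≗r′ = []
ddSum-cong c i lo hi (suc d) r≗r′ =
  (refl , setAt-cong i _ (setAt-cong (i ∸ 1) _ r≗r′)) ∷ ddSum-cong c i lo hi d r≗r′

ddTerm-cong : ∀ i c {e f} → e ≗ₘ f → ddTerm i (c , e) ≃ₚ ddTerm i (c , f)
ddTerm-cong i c {e} {f} e≗f rewrite at e≗f (i ∸ 1) | at e≗f i
  with nth f i <ᵇ nth f (i ∸ 1) | nth f (i ∸ 1) <ᵇ nth f i
... | true | _ = ddSum-cong _ i _ _ _ (setAt-cong i 0 (setAt-cong (i ∸ 1) 0 e≗f))
... | false | true = ddSum-cong _ i _ _ _ (setAt-cong i 0 (setAt-cong (i ∸ 1) 0 e≗f))
... | false | false = []

dd-cong : ∀ i {p q} → p ≃ₚ q → dd i p ≃ₚ dd i q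
dd-cong i [] = []
dd-cong i ((refl , e≗f) ∷ p≃q) = PW.++⁺ (ddTerm-cong i _ e≗f) (dd-cong i p≃q)

substMono-cong : ∀ {s s′ : ℕ → Poly} → (∀ i → s i ≡ s′ i) →
                 ∀ j {e f} → e ≗ₘ f → substMono s j e ≡ substMono s′ j f
substMono-cong s≗s′ j {[]} {[]} e≗f = refl
substMono-cong s≗s′ j {a ∷ e} {[]} e≗f
  rewrite at e≗f 0 | substMono-cong s≗s′ (suc j) {e} {[]} (mk≗ₘ λ q → at e≗f (suc q)) = refl
substMono-cong s≗s′ j {[]} {b ∷ f} e≗f
  rewrite sym (at e≗f 0) | sym (substMono-cong s≗s′ (suc j) {[]} {f} (mk≗ₘ λ q → at e≗f (suc q))) = refl
substMono-cong s≗s′ j {a ∷ e} {b ∷ f} e≗f =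
  cong₂ pmul (cong₂ ppow (s≗s′ j) (at e≗f 0))
             (substMono-cong s≗s′ (suc j) {e} {f} (mk≗ₘ λ q → at e≗f (suc q)))

substPoly-cong : ∀ {s s′ : ℕ → Poly} → (∀ i → s i ≡ s′ i) →
                 ∀ {p q} → p ≃ₚ q → substPoly s p ≡ substPoly s′ q
substPoly-cong s≗s′ [] = refl
substPoly-cong s≗s′ {(c , _) ∷ _} ((refl , e≗f) ∷ p≃q) =
  cong₂ _++_ (cong (scale c) (substMono-cong s≗s′ 1 e≗f)) (substPoly-cong s≗s′ p≃q)

act-cong : ∀ π ρ → (∀ i → permApp π i ≡ permApp ρ i) → ∀ {p q} → p ≃ₚ q → act π p ≡ act ρ q
act-cong π ρ π≗ρ = substPoly-cong (λ i → cong var (π≗ρ i))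

-- Divided differences of the top Schubert polynomial

ddUpTo : ℕ → Poly → Poly
ddUpTo zero p = p
ddUpTo (suc j) p = dd (suc j) (ddUpTo j p)

ddTerm-step : ∀ j c e b → nth e j ≡ suc b → nth e (suc j) ≡ b →
              ddTerm (suc j) (c , e) ≃ₚ (c , setAt e j b) ∷ []
ddTerm-step j c e b eⱼ eⱼ₊₁
  rewrite eⱼ | eⱼ₊₁ | <⇒<ᵇ-true (ℕP.n<1+n b) | ℕP.m+n∸n≡m 1 b = (refl , mk≗ₘ exponent) ∷ []
  where
  exponent : ∀ q → nth (setAt (setAt (setAt (setAt e j 0) (suc j) 0) j (b + 0)) (suc j) b) q ≡ nth (setAt e j b) q
  exponent q
    rewrite nth-setAt (setAt (setAt (setAt e j 0) (suc j) 0) j (b + 0)) (suc j) b q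
          | nth-setAt (setAt (setAt e j 0) (suc j) 0) j (b + 0) q
          | nth-setAt (setAt e j 0) (suc j) 0 q | nth-setAt e j 0 q | nth-setAt e j b q
    with q ≡ᵇ j in q≡j | q ≡ᵇ suc j in q≡1+j
  ... | true | true = ⊥-elim (ℕP.1+n≢n (trans (sym (≡ᵇ-true⇒≡ q (suc j) q≡1+j)) (≡ᵇ-true⇒≡ q j q≡j)))
  ... | true | false = ℕP.+-identityʳ b
  ... | false | true rewrite ≡ᵇ-true⇒≡ q (suc j) q≡1+j = sym eⱼ₊₁
  ... | false | false = refl

-- exponent of x_{p+1} in ∂ⱼ ⋯ ∂₁ (x₁^N x₂^(N-1) ⋯ x_N)
staircase : ℕ → ℕ → ℕ → ℕ
staircase N j p = if p <ᵇ j then N ∸ 1 ∸ p else N ∸ p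

stair : ℕ → ℕ → Mono
stair N zero = downFrom (suc N)
stair N (suc j) = setAt (stair N j) j (N ∸ suc j)

nth-downFrom : ∀ N p → nth (downFrom N) p ≡ N ∸ 1 ∸ p
nth-downFrom zero p = sym (ℕP.0∸n≡0 p)
nth-downFrom (suc N) zero = refl
nth-downFrom (suc zero) (suc p) = refl
nth-downFrom (suc (suc N)) (suc p) = nth-downFrom (suc N) p

nth-stair : ∀ N j p → nth (stair N j) p ≡ staircase N j p
nth-stair N zero p = nth-downFrom (suc N) p
nth-stair N (suc j) p rewrite nth-setAt (stair N j) j (N ∸ suc j) p | nth-stair N j p with ℕP.<-cmp p j
... | tri< p<j _ _
  rewrite ≢⇒≡ᵇ-false p j (ℕP.<⇒≢ p<j) | <⇒<ᵇ-true p<j | <⇒<ᵇ-true (ℕP.m<n⇒m<1+n p<j) = refl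
... | tri≈ _ refl _ rewrite ≡ᵇ-refl p | <⇒<ᵇ-true (ℕP.n<1+n p) = sym (ℕP.∸-+-assoc N 1 p)
... | tri> _ _ j<p
  rewrite ≢⇒≡ᵇ-false p j (ℕP.>⇒≢ j<p) | ≤⇒<ᵇ-false (ℕP.<⇒≤ j<p) | ≤⇒<ᵇ-false j<p = refl

ddUpTo-schubTop-stair : ∀ N j → j ≤ N → ddUpTo j (schubTop (suc N)) ≃ₚ (ℤ.1ℤ , stair N j) ∷ []
ddUpTo-schubTop-stair N zero _ = ≃ₚ-refl
ddUpTo-schubTop-stair N (suc j) 1+j≤N =
  ≃ₚ-trans (dd-cong (suc j) (ddUpTo-schubTop-stair N j (ℕP.<⇒≤ 1+j≤N)))
           (PW.++⁺ (ddTerm-step j ℤ.1ℤ (stair N j) (N ∸ suc j) exponentⱼ exponentⱼ₊₁) [])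
  where
  exponentⱼ : nth (stair N j) j ≡ suc (N ∸ suc j)
  exponentⱼ rewrite nth-stair N j j | ≤⇒<ᵇ-false (ℕP.≤-refl {j}) = ℕP.+-∸-assoc 1 1+j≤N
  exponentⱼ₊₁ : nth (stair N j) (suc j) ≡ N ∸ suc j
  exponentⱼ₊₁ rewrite nth-stair N j (suc j) | ≤⇒<ᵇ-false (ℕP.n≤1+n j) = refl

ddUpTo-schubTop : ∀ N → ddUpTo N (schubTop (suc N)) ≃ₚ schubTop N
ddUpTo-schubTop N = ≃ₚ-trans (ddUpTo-schubTop-stair N N ℕP.≤-refl) ((refl , mk≗ₘ exponent) ∷ [])
  where
  exponent : ∀ p → nth (stair N N) p ≡ nth (downFrom N) p
  exponent p rewrite nth-stair N N p | nth-downFrom N p with p <ᵇ N in p<N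
  ... | true = refl
  ... | false = trans (ℕP.m≤n⇒m∸n≡0 N≤p) (sym (ℕP.m≤n⇒m∸n≡0 (ℕP.≤-trans (ℕP.m∸n≤m N 1) N≤p)))
    where N≤p = <ᵇ-false⇒≥ p N p<N

-- Stability of Schubert polynomials under S_N ⊂ S_{N+1}

NoAscent : List ℕ → Set
NoAscent π = firstAscent π ≡ nothing

schubAux-ascent : ∀ f π i → firstAscent π ≡ just i → schubAux (suc f) π ≡ dd i (schubAux f (swapAdj π i))
schubAux-ascent f π i eq with firstAscent π
schubAux-ascent f π i refl | just .i = refl

schubAux-noAscent : ∀ f π → NoAscent π → schubAux f π ≡ schubTop (length π)
schubAux-noAscent zero π _ = refl
schubAux-noAscent (suc f) π eq with firstAscent π
schubAux-noAscent (suc f) π refl | nothing = refl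

noAscent-head : ∀ a b l → NoAscent (a ∷ b ∷ l) → (a <ᵇ b) ≡ false
noAscent-head a b l eq with a <ᵇ b
noAscent-head a b l () | true
... | false = refl

noAscent-tail : ∀ a l → NoAscent (a ∷ l) → NoAscent l
noAscent-tail a [] _ = refl
noAscent-tail a (b ∷ l) eq with a <ᵇ b | firstAscent (b ∷ l)
noAscent-tail a (b ∷ l) () | true | _
noAscent-tail a (b ∷ l) () | false | just _
... | false | nothing = refl

noAscent-∷ : ∀ a b l → (a <ᵇ b) ≡ false → NoAscent (b ∷ l) → NoAscent (a ∷ b ∷ l)
noAscent-∷ a b l a≮b eq rewrite a≮b | eq = refl

noAscent-++ʳ : ∀ xs ys → NoAscent (xs ++ ys) → NoAscent ys
noAscent-++ʳ [] ys eq = eq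
noAscent-++ʳ (x ∷ xs) ys eq = noAscent-++ʳ xs ys (noAscent-tail x (xs ++ ys) eq)

noAscent-++ˡ : ∀ xs ys → NoAscent (xs ++ ys) → NoAscent xs
noAscent-++ˡ [] ys eq = refl
noAscent-++ˡ (a ∷ []) ys eq = refl
noAscent-++ˡ (a ∷ b ∷ xs) ys eq =
  noAscent-∷ a b xs (noAscent-head a b (xs ++ ys) eq) (noAscent-++ˡ (b ∷ xs) ys (noAscent-tail a (b ∷ xs ++ ys) eq))

firstAscent-∷∷ : ∀ a b π {i} → firstAscent (a ∷ b ∷ π) ≡ just i →
                 (a < b × i ≡ 1) ⊎ ((a <ᵇ b) ≡ false × ∃[ j ] (firstAscent (b ∷ π) ≡ just j × i ≡ suc j))
firstAscent-∷∷ a b π eq with a <ᵇ b in a<b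
firstAscent-∷∷ a b π refl | true = inj₁ (<ᵇ-true⇒< a b a<b , refl)
... | false with firstAscent (b ∷ π)
firstAscent-∷∷ a b π refl | false | just j = inj₂ (refl , j , refl , refl)

firstAscent-suc : ∀ π i → firstAscent π ≡ just i → ∃[ i′ ] i ≡ suc i′
firstAscent-suc (a ∷ b ∷ π) i eq with firstAscent-∷∷ a b π eq
... | inj₁ (_ , refl) = 0 , refl
... | inj₂ (_ , j , _ , refl) = j , refl

firstAscent-++ : ∀ π l i → firstAscent π ≡ just i → firstAscent (π ++ l) ≡ just i
firstAscent-++ (a ∷ b ∷ π) l i eq with firstAscent-∷∷ a b π eq
... | inj₁ (a<b , refl) rewrite <⇒<ᵇ-true a<b = refl
... | inj₂ (a≮b , j , eq′ , refl) rewrite a≮b | firstAscent-++ (b ∷ π) l j eq′ = refl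

swapAdj-++ : ∀ π l i → firstAscent π ≡ just i → swapAdj (π ++ l) i ≡ swapAdj π i ++ l
swapAdj-++ (a ∷ b ∷ π) l i eq with firstAscent-∷∷ a b π eq
... | inj₁ (_ , refl) = refl
... | inj₂ (_ , j , eq′ , refl) with firstAscent-suc (b ∷ π) j eq′
...   | j′ , refl = cong (a ∷_) (swapAdj-++ (b ∷ π) l (suc j′) eq′)

firstAscent-max : ∀ u x M t → NoAscent (u ++ x ∷ []) → x < M →
                  firstAscent (u ++ x ∷ M ∷ t) ≡ just (suc (length u))
firstAscent-max [] x M t _ x<M rewrite <⇒<ᵇ-true x<M = refl
firstAscent-max (a ∷ []) x M t eq x<M rewrite noAscent-head a x [] eq | <⇒<ᵇ-true x<M = refl
firstAscent-max (a ∷ b ∷ u) x M t eq x<M =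
  trans (if-cong (noAscent-head a b (u ++ x ∷ []) eq))
        (cong (Maybe.map suc) (firstAscent-max (b ∷ u) x M t (noAscent-tail a (b ∷ u ++ x ∷ []) eq) x<M))

swapAdj-length : ∀ u x y t → swapAdj (u ++ x ∷ y ∷ t) (suc (length u)) ≡ u ++ y ∷ x ∷ t
swapAdj-length [] x y t = refl
swapAdj-length (a ∷ []) x y t = refl
swapAdj-length (a ∷ b ∷ u) x y t = cong (a ∷_) (swapAdj-length (b ∷ u) x y t)

length-swapAdj : ∀ l j → length (swapAdj l j) ≡ length l
length-swapAdj [] j = refl
length-swapAdj (a ∷ []) j = refl
length-swapAdj (a ∷ b ∷ l) zero = refl
length-swapAdj (a ∷ b ∷ l) (suc zero) = refl
length-swapAdj (a ∷ b ∷ l) (suc (suc j)) = cong suc (length-swapAdj (b ∷ l) (suc j))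

All-swapAdj : ∀ {P : ℕ → Set} l j → All P l → All P (swapAdj l j)
All-swapAdj [] j ps = ps
All-swapAdj (a ∷ []) j ps = ps
All-swapAdj (a ∷ b ∷ l) zero ps = ps
All-swapAdj (a ∷ b ∷ l) (suc zero) (pa ∷ pb ∷ ps) = pb ∷ pa ∷ ps
All-swapAdj (a ∷ b ∷ l) (suc (suc j)) (pa ∷ ps) = pa ∷ All-swapAdj (b ∷ l) (suc j) ps

length-filterᵇ-∷ : ∀ {A : Set} (p : A → Bool) x xs →
                   length (filterᵇ p (x ∷ xs)) ≡ (if p x then suc (length (filterᵇ p xs)) else length (filterᵇ p xs))
length-filterᵇ-∷ p x xs with p x
... | true = refl
... | false = refl

length-filterᵇ-++ : ∀ {A : Set} (p : A → Bool) xs ys →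
                    length (filterᵇ p (xs ++ ys)) ≡ length (filterᵇ p xs) + length (filterᵇ p ys)
length-filterᵇ-++ p xs ys = trans (cong length (LP.filter-++ (T? ∘ p) xs ys)) (LP.length-++ (filterᵇ p xs))

length-filterᵇ-swapAdj : ∀ (p : ℕ → Bool) l j → length (filterᵇ p (swapAdj l j)) ≡ length (filterᵇ p l)
length-filterᵇ-swapAdj p [] j = refl
length-filterᵇ-swapAdj p (a ∷ []) j = refl
length-filterᵇ-swapAdj p (a ∷ b ∷ l) zero = refl
length-filterᵇ-swapAdj p (a ∷ b ∷ l) (suc zero)
  rewrite length-filterᵇ-∷ p b (a ∷ l) | length-filterᵇ-∷ p a l
        | length-filterᵇ-∷ p a (b ∷ l) | length-filterᵇ-∷ p b l with p a | p b
... | true | true = refl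
... | true | false = refl
... | false | true = refl
... | false | false = refl
length-filterᵇ-swapAdj p (a ∷ b ∷ l) (suc (suc j)) =
  trans (length-filterᵇ-∷ p a (swapAdj (b ∷ l) (suc j)))
        (trans (cong (λ n → if p a then suc n else n) (length-filterᵇ-swapAdj p (b ∷ l) (suc j)))
               (sym (length-filterᵇ-∷ p a (b ∷ l))))

nonInv-ascent : ∀ π i → firstAscent π ≡ just i → nonInv π ≡ suc (nonInv (swapAdj π i))
nonInv-ascent (a ∷ b ∷ π) i eq with firstAscent-∷∷ a b π eq
... | inj₁ (a<b , refl)
  rewrite length-filterᵇ-∷ (a <ᵇ_) b π | <⇒<ᵇ-true a<b
        | length-filterᵇ-∷ (b <ᵇ_) a π | ≤⇒<ᵇ-false (ℕP.<⇒≤ a<b)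
  = regroup (length (filterᵇ (a <ᵇ_) π)) (length (filterᵇ (b <ᵇ_) π)) (nonInv π)
  where
  regroup : ∀ x y z → suc x + (y + z) ≡ suc (y + (x + z))
  regroup = solve-∀
... | inj₂ (_ , j , eq′ , refl) with firstAscent-suc (b ∷ π) j eq′
... | j′ , refl =
  trans (cong₂ _+_ (sym (length-filterᵇ-swapAdj (a <ᵇ_) (b ∷ π) (suc j′)))
                   (nonInv-ascent (b ∷ π) (suc j′) eq′))
        (ℕP.+-suc _ _)

nonInv-++-max : ∀ M π → All (_< M) π → nonInv (π ++ M ∷ []) ≡ nonInv π + length π
nonInv-++-max M [] [] = refl
nonInv-++-max M (a ∷ π) (a<M ∷ π<M)
  rewrite length-filterᵇ-++ (a <ᵇ_) π (M ∷ []) | <⇒<ᵇ-true a<M | nonInv-++-max M π π<M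
  = regroup (length (filterᵇ (a <ᵇ_) π)) (nonInv π) (length π)
  where
  regroup : ∀ x y n → x + 1 + (y + n) ≡ x + y + suc n
  regroup = solve-∀

noAscent-max : ∀ x M t → x < M → NoAscent (x ∷ t) → NoAscent (M ∷ x ∷ t)
noAscent-max x M t x<M = noAscent-∷ M x t (≤⇒<ᵇ-false (ℕP.<⇒≤ x<M))

-- each ascent step moves M one place to the left, until M ∷ t is w₀-like
schubAux-bubble : ∀ M T {u} → Reverse u → ∀ t g → NoAscent (u ++ t) → All (_< M) u → NoAscent (M ∷ t) →
                  length u ≤ g → length (u ++ M ∷ t) ≡ T →
                  schubAux g (u ++ M ∷ t) ≃ₚ ddUpTo (length u) (schubTop T)
schubAux-bubble M T Reverse.[] t g _ _ M∷t↓ _ refl rewrite schubAux-noAscent g (M ∷ t) M∷t↓ = ≃ₚ-refl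
schubAux-bubble M T (u ∶ u-view ∶ʳ x) t zero _ _ _ u+1≤0 _
  rewrite LP.length-++ u {x ∷ []} | ℕP.+-comm (length u) 1 with () ← u+1≤0
schubAux-bubble M T (u ∶ u-view ∶ʳ x) t (suc g) u++x++t↓ u++x<M M∷t↓ u+1≤g+1 lenT
  rewrite LP.++-assoc u (x ∷ []) (M ∷ t) | LP.length-++ u {x ∷ []} | ℕP.+-comm (length u) 1
        | schubAux-ascent g (u ++ x ∷ M ∷ t) (suc (length u))
            (firstAscent-max u x M t (noAscent-++ˡ (u ++ x ∷ []) t u++x++t↓) (proj₂ (AP.∷ʳ⁻ u++x<M)))
        | swapAdj-length u x M t
  = dd-cong (suc (length u))
      (schubAux-bubble M T u-view (x ∷ t) g u++x∷t↓ (proj₁ (AP.∷ʳ⁻ u++x<M))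
        (noAscent-max x M t x<M (noAscent-++ʳ u (x ∷ t) u++x∷t↓)) (ℕP.≤-pred u+1≤g+1) lenT′)
  where
  x<M = proj₂ (AP.∷ʳ⁻ u++x<M)
  u++x∷t↓ : NoAscent (u ++ x ∷ t)
  u++x∷t↓ = subst NoAscent (LP.++-assoc u (x ∷ []) t) u++x++t↓
  lenT′ : length (u ++ M ∷ x ∷ t) ≡ T
  lenT′ = trans (LP.length-++ u) (trans (sym (LP.length-++ u)) lenT)

schubAux-++-max-noAscent : ∀ M π g → All (_< M) π → NoAscent π → length π ≤ g →
                           schubAux g (π ++ M ∷ []) ≃ₚ schubTop (length π)
schubAux-++-max-noAscent M π g π<M π↓ len≤g =
  ≃ₚ-trans (schubAux-bubble M (suc (length π)) (reverseView π) [] g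
              (subst NoAscent (sym (LP.++-identityʳ π)) π↓) π<M refl len≤g
              (trans (LP.length-++ π) (ℕP.+-comm (length π) 1)))
           (ddUpTo-schubTop (length π))

schubAux-++-max : ∀ M f π → All (_< M) π → f ≡ nonInv π →
                  schubAux (f + length π) (π ++ M ∷ []) ≃ₚ schubAux f π
schubAux-++-max M f π π<M f≡ with firstAscent π in π-ascent
... | nothing rewrite schubAux-noAscent f π π-ascent =
  schubAux-++-max-noAscent M π (f + length π) π<M π-ascent (ℕP.m≤n+m (length π) f)
schubAux-++-max M zero π π<M f≡ | just i with () ← trans f≡ (nonInv-ascent π i π-ascent)
schubAux-++-max M (suc f) π π<M f≡ | just i
  rewrite schubAux-ascent (f + length π) (π ++ M ∷ []) i (firstAscent-++ π (M ∷ []) i π-ascent)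
        | swapAdj-++ π (M ∷ []) i π-ascent
        | schubAux-ascent f π i π-ascent
        | sym (length-swapAdj π i)
  = dd-cong i (schubAux-++-max M f (swapAdj π i) (All-swapAdj π i π<M)
                 (ℕP.suc-injective (trans f≡ (nonInv-ascent π i π-ascent))))

schub-++-max : ∀ M π → All (_< M) π → schub (π ++ M ∷ []) ≃ₚ schub π
schub-++-max M π π<M rewrite nonInv-++-max M π π<M = schubAux-++-max M (nonInv π) π π<M refl

-- Words: initial letters, conv and std

memb-here : ∀ a l → memb a (a ∷ l) ≡ true
memb-here a l rewrite ≡ᵇ-refl a = refl

memb-there : ∀ c a l → memb c l ≡ true → memb c (a ∷ l) ≡ true
memb-there c a l c∈l with c ≡ᵇ a
... | true = refl
... | false = c∈l

memb-≢ : ∀ c a l → (c ≡ᵇ a) ≡ false → memb c (a ∷ l) ≡ memb c l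
memb-≢ c a l c≢a rewrite c≢a = refl

∈⇒memb : ∀ {a l} → a ∈ l → memb a l ≡ true
∈⇒memb {a} {b ∷ l} (here refl) = memb-here a l
∈⇒memb {a} {b ∷ l} (there a∈l) = memb-there a b l (∈⇒memb a∈l)

memb-++ˡ : ∀ a xs ys → memb a xs ≡ true → memb a (xs ++ ys) ≡ true
memb-++ˡ a (x ∷ xs) ys a∈xs with a ≡ᵇ x
... | true = refl
... | false = memb-++ˡ a xs ys a∈xs

memb-++ʳ : ∀ a xs ys → memb a ys ≡ true → memb a (xs ++ ys) ≡ true
memb-++ʳ a [] ys a∈ys = a∈ys
memb-++ʳ a (x ∷ xs) ys a∈ys = memb-there a x (xs ++ ys) (memb-++ʳ a xs ys a∈ys)

count-∷ : ∀ a b l → count a (b ∷ l) ≡ (if a ≡ᵇ b then suc (count a l) else count a l)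
count-∷ a b l = length-filterᵇ-∷ (a ≡ᵇ_) b l

count-++ : ∀ a xs ys → count a (xs ++ ys) ≡ count a xs + count a ys
count-++ a = length-filterᵇ-++ (a ≡ᵇ_)

memb⇒count-pos : ∀ a l → memb a l ≡ true → ∃[ m ] count a l ≡ suc m
memb⇒count-pos a (b ∷ l) a∈ with a ≡ᵇ b
... | true = count a l , refl
... | false = memb⇒count-pos a l a∈

count-pos⇒memb : ∀ a l m → count a l ≡ suc m → memb a l ≡ true
count-pos⇒memb a (b ∷ l) m eq with a ≡ᵇ b
... | true = refl
... | false = count-pos⇒memb a l m eq

count-initLetters : ∀ seen w b →
  count b (initLettersAux seen w) ≡ (if memb b seen then 0 else (if memb b w then 1 else 0))
count-initLetters seen [] b with memb b seen
... | true = refl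
... | false = refl
count-initLetters seen (a ∷ w) b with memb a seen in a∈seen
... | true with b ≡ᵇ a in b≟a
...   | true rewrite ≡ᵇ-true⇒≡ b a b≟a | count-initLetters seen w a | a∈seen = refl
...   | false = count-initLetters seen w b
count-initLetters seen (a ∷ w) b | false = trans (count-∷ b a (initLettersAux (a ∷ seen) w)) new-letter
  where
  new-letter : (if b ≡ᵇ a then suc (count b (initLettersAux (a ∷ seen) w)) else count b (initLettersAux (a ∷ seen) w))
               ≡ (if memb b seen then 0 else (if memb b (a ∷ w) then 1 else 0))
  new-letter with b ≡ᵇ a in b≟a
  ... | true rewrite ≡ᵇ-true⇒≡ b a b≟a | a∈seen =
    cong suc (trans (count-initLetters (a ∷ seen) w a) (if-cong (memb-here a seen)))
  ... | false = trans (count-initLetters (a ∷ seen) w b) (if-cong (memb-≢ b a seen b≟a))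

Occurs : ℕ → List ℕ → List ℕ → Set
Occurs c seen v = memb c seen ≡ true ⊎ memb c v ≡ true

occurs-skip : ∀ c a seen v → memb a seen ≡ true → Occurs c seen (a ∷ v) → Occurs c seen v
occurs-skip c a seen v a∈seen (inj₁ c∈seen) = inj₁ c∈seen
occurs-skip c a seen v a∈seen (inj₂ c∈a∷v) with c ≡ᵇ a in c≟a
... | true rewrite ≡ᵇ-true⇒≡ c a c≟a = inj₁ a∈seen
... | false = inj₂ c∈a∷v

occurs-record : ∀ c a seen v → Occurs c seen (a ∷ v) → Occurs c (a ∷ seen) v
occurs-record c a seen v (inj₁ c∈seen) = inj₁ (memb-there c a seen c∈seen)
occurs-record c a seen v (inj₂ c∈a∷v) with c ≡ᵇ a
... | true = inj₁ refl
... | false = inj₂ c∈a∷v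

initLettersAux-snoc : ∀ seen w c → Occurs c seen w → initLettersAux seen (w ++ c ∷ []) ≡ initLettersAux seen w
initLettersAux-snoc seen [] c (inj₁ c∈seen) rewrite c∈seen = refl
initLettersAux-snoc seen (a ∷ w) c occ with memb a seen in a∈seen
... | true = initLettersAux-snoc seen w c (occurs-skip c a seen w a∈seen occ)
... | false = cong (a ∷_) (initLettersAux-snoc (a ∷ seen) w c (occurs-record c a seen w occ))

split-last : ∀ y ys → ∃[ init ] y ∷ ys ≡ init ++ lastOr y ys ∷ []
split-last y [] = [] , refl
split-last y (z ∷ zs) with split-last z zs
... | init , eq = y ∷ init , cong (y ∷_) eq

count-zero⇒All≢ : ∀ a l → count a l ≡ 0 → All (λ b → (a ≡ᵇ b) ≡ false) l
count-zero⇒All≢ a [] _ = []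
count-zero⇒All≢ a (b ∷ l) eq with a ≡ᵇ b in a≟b
... | false = a≟b ∷ count-zero⇒All≢ a l eq

record LastInitial (w : List ℕ) (a : ℕ) : Set where
  field
    earlier : List ℕ
    initLetters-≡ : initLetters w ≡ earlier ++ a ∷ []
    fresh : All (λ b → (a ≡ᵇ b) ≡ false) earlier
    occurs : memb a w ≡ true

lastInitial : ∀ x w → LastInitial (x ∷ w) (lastOr 0 (initLetters (x ∷ w)))
lastInitial x w with split-last x (initLettersAux (x ∷ []) w)
... | earlier , split = record
  { earlier = earlier
  ; initLetters-≡ = split
  ; fresh = count-zero⇒All≢ a earlier (proj₂ occurs-once)
  ; occurs = proj₁ occurs-once
  }
  where
  a = lastOr x (initLettersAux (x ∷ []) w)
  count-a : count a (initLetters (x ∷ w)) ≡ count a earlier + 1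
  count-a = trans (cong (count a) split)
                  (trans (count-++ a earlier (a ∷ []))
                         (cong (count a earlier +_) (trans (count-∷ a a []) (if-cong (≡ᵇ-refl a)))))
  occurs-once : memb a (x ∷ w) ≡ true × count a earlier ≡ 0
  occurs-once with memb a (x ∷ w) | trans (sym (count-initLetters [] (x ∷ w) a)) count-a
  ... | true | eq = refl , sym (ℕP.suc-injective (trans eq (ℕP.+-comm (count a earlier) 1)))
  ... | false | eq with () ← trans eq (ℕP.+-comm (count a earlier) 1)

-- appending the last initial letter a only extends the block of a, which comes last
concatMap-initLetters-snoc : ∀ {w a} → LastInitial w a → ∀ (F G : ℕ → List ℕ) x →
  (∀ b → (a ≡ᵇ b) ≡ false → F b ≡ G b) → F a ≡ G a ++ x ∷ [] →
  concatMap F (initLetters (w ++ a ∷ [])) ≡ concatMap G (initLetters w) ++ x ∷ []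
concatMap-initLetters-snoc {w} {a} last F G x F≗G Fa = begin
    concatMap F (initLetters (w ++ a ∷ []))
  ≡⟨ cong (concatMap F) (trans (initLettersAux-snoc [] w a (inj₂ occurs)) initLetters-≡) ⟩
    concatMap F (earlier ++ a ∷ [])
  ≡⟨ LP.concatMap-++ F earlier (a ∷ []) ⟩
    concatMap F earlier ++ F a ++ []
  ≡⟨ cong₂ (λ u v → u ++ v ++ []) (cong concat (LP.map-cong-local (All.map (F≗G _) fresh))) Fa ⟩
    concatMap G earlier ++ (G a ++ x ∷ []) ++ []
  ≡⟨ cong (concatMap G earlier ++_) (trans (LP.++-identityʳ _) (cong (_++ x ∷ []) (sym (LP.++-identityʳ (G a))))) ⟩
    concatMap G earlier ++ (G a ++ []) ++ x ∷ []
  ≡⟨ sym (LP.++-assoc (concatMap G earlier) (G a ++ []) (x ∷ [])) ⟩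
    (concatMap G earlier ++ G a ++ []) ++ x ∷ []
  ≡⟨ cong (_++ x ∷ []) (sym (LP.concatMap-++ G earlier (a ∷ []))) ⟩
    concatMap G (earlier ++ a ∷ []) ++ x ∷ []
  ≡⟨ cong (λ L → concatMap G L ++ x ∷ []) (sym initLetters-≡) ⟩
    concatMap G (initLetters w) ++ x ∷ []
  ∎
  where
  open ≡-Reasoning
  open LastInitial last

count-snoc : ∀ b w c → count b (w ++ c ∷ []) ≡ count b w + (if b ≡ᵇ c then 1 else 0)
count-snoc b w c = trans (count-++ b w (c ∷ [])) (cong (count b w +_) (count-∷ b c []))

replicate-snoc : ∀ n (x : ℕ) → replicate (n + 1) x ≡ replicate n x ++ x ∷ []
replicate-snoc zero x = refl
replicate-snoc (suc n) x = cong (x ∷_) (replicate-snoc n x)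

conv-snoc : ∀ {w a} → LastInitial w a → conv (w ++ a ∷ []) ≡ conv w ++ a ∷ []
conv-snoc {w} {a} last =
  concatMap-initLetters-snoc last (λ b → replicate (count b (w ++ a ∷ [])) b) (λ b → replicate (count b w) b) a
    (λ b a≢b → cong (λ n → replicate n b)
                 (trans (count-snoc b w a) (trans (cong (count b w +_) (if-cong (trans (≡ᵇ-sym b a) a≢b)))
                                                  (ℕP.+-identityʳ (count b w)))))
    (trans (cong (λ n → replicate n a) (trans (count-snoc a w a) (cong (count a w +_) (if-cong (≡ᵇ-refl a)))))
           (replicate-snoc (count a w) a))

oneTo-suc : ∀ n → oneTo (suc n) ≡ oneTo n ++ suc n ∷ []
oneTo-suc n = trans (cong (map suc) (sym (LP.upTo-∷ʳ n))) (LP.map-++ suc (upTo n) (n ∷ []))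

length-oneTo : ∀ n → length (oneTo n) ≡ n
length-oneTo n = trans (LP.length-map suc (upTo n)) (LP.length-upTo n)

oneTo-bounds : ∀ n → All (λ b → 1 ≤ b × b ≤ n) (oneTo n)
oneTo-bounds n = AP.map⁺ (AP.applyUpTo⁺₁ (λ i → i) n (λ i<n → s≤s z≤n , i<n))

zip-snoc : ∀ (xs ys : List ℕ) x y → length xs ≡ length ys →
           zip (xs ++ x ∷ []) (ys ++ y ∷ []) ≡ zip xs ys ++ (x , y) ∷ []
zip-snoc [] [] x y _ = refl
zip-snoc (x′ ∷ xs) (y′ ∷ ys) x y eq = cong ((x′ , y′) ∷_) (zip-snoc xs ys x y (ℕP.suc-injective eq))

positions-snoc : ∀ b w c →
  positions b (w ++ c ∷ []) ≡ positions b w ++ (if b ≡ᵇ c then suc (length w) ∷ [] else [])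
positions-snoc b w c = begin
    map proj₁ (filterᵇ at-b (zip (oneTo (length (w ++ c ∷ []))) (w ++ c ∷ [])))
  ≡⟨ cong (λ n → map proj₁ (filterᵇ at-b (zip (oneTo n) (w ++ c ∷ []))))
          (trans (LP.length-++ w) (ℕP.+-comm (length w) 1)) ⟩
    map proj₁ (filterᵇ at-b (zip (oneTo (suc n)) (w ++ c ∷ [])))
  ≡⟨ cong (λ is → map proj₁ (filterᵇ at-b (zip is (w ++ c ∷ [])))) (oneTo-suc n) ⟩
    map proj₁ (filterᵇ at-b (zip (oneTo n ++ suc n ∷ []) (w ++ c ∷ [])))
  ≡⟨ cong (λ ps → map proj₁ (filterᵇ at-b ps)) (zip-snoc (oneTo n) w (suc n) c (length-oneTo n)) ⟩
    map proj₁ (filterᵇ at-b (zip (oneTo n) w ++ (suc n , c) ∷ []))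
  ≡⟨ cong (map proj₁) (LP.filter-++ (T? ∘ at-b) (zip (oneTo n) w) ((suc n , c) ∷ [])) ⟩
    map proj₁ (filterᵇ at-b (zip (oneTo n) w) ++ filterᵇ at-b ((suc n , c) ∷ []))
  ≡⟨ LP.map-++ proj₁ (filterᵇ at-b (zip (oneTo n) w)) _ ⟩
    positions b w ++ map proj₁ (filterᵇ at-b ((suc n , c) ∷ []))
  ≡⟨ cong (positions b w ++_) last-position ⟩
    positions b w ++ (if b ≡ᵇ c then suc n ∷ [] else [])
  ∎
  where
  open ≡-Reasoning
  n = length w
  at-b : ℕ × ℕ → Bool
  at-b t = b ≡ᵇ proj₂ t
  last-position : map proj₁ (filterᵇ at-b ((suc n , c) ∷ [])) ≡ (if b ≡ᵇ c then suc n ∷ [] else [])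
  last-position with b ≡ᵇ c
  ... | true = refl
  ... | false = refl

sigma-snoc : ∀ {w a} → LastInitial w a → sigma (w ++ a ∷ []) ≡ sigma w ++ suc (length w) ∷ []
sigma-snoc {w} {a} last =
  concatMap-initLetters-snoc last (λ b → positions b (w ++ a ∷ [])) (λ b → positions b w) (suc (length w))
    (λ b a≢b → trans (positions-snoc b w a)
                 (trans (cong (positions b w ++_) (if-cong (trans (≡ᵇ-sym b a) a≢b))) (LP.++-identityʳ (positions b w))))
    (trans (positions-snoc a w a) (cong (positions a w ++_) (if-cong (≡ᵇ-refl a))))

memb-concatMap : ∀ b (f : ℕ → List ℕ) L → memb b L ≡ true → memb b (f b) ≡ true →
                 memb b (concatMap f L) ≡ true
memb-concatMap b f (c ∷ L) b∈L b∈fb with b ≡ᵇ c in b≟c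
... | true rewrite ≡ᵇ-true⇒≡ b c b≟c = memb-++ˡ c (f c) _ b∈fb
... | false = memb-++ʳ b (f c) _ (memb-concatMap b f L b∈L b∈fb)

memb-conv : ∀ b w → memb b w ≡ true → memb b (conv w) ≡ true
memb-conv b w b∈w with memb⇒count-pos b w b∈w
... | m , count≡ = memb-concatMap b (λ c → replicate (count c w) c) (initLetters w) b∈initLetters b∈block
  where
  b∈initLetters : memb b (initLetters w) ≡ true
  b∈initLetters = count-pos⇒memb b (initLetters w) 0 (trans (count-initLetters [] w b) (if-cong b∈w))
  b∈block : memb b (replicate (count b w) b) ≡ true
  b∈block rewrite count≡ = memb-here b (replicate m b)

All-initLettersAux : ∀ {P : ℕ → Set} seen w → All P w → All P (initLettersAux seen w)
All-initLettersAux seen [] [] = []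
All-initLettersAux seen (a ∷ w) (pa ∷ pw) with memb a seen
... | true = All-initLettersAux seen w pw
... | false = pa ∷ All-initLettersAux (a ∷ seen) w pw

All-conv : ∀ {P : ℕ → Set} w → All P w → All P (conv w)
All-conv w pw = AP.concat⁺ (AP.map⁺ (All.map (AP.replicate⁺ _) (All-initLettersAux [] w pw)))

-- the value that std gives to the next repeated letter
stdNext : List ℕ → ℕ → List ℕ → ℕ
stdNext seen nxt [] = nxt
stdNext seen nxt (a ∷ v) = if memb a seen then stdNext seen (suc nxt) v else stdNext (a ∷ seen) nxt v

stdAux-snoc : ∀ seen nxt v c → Occurs c seen v →
              stdAux seen nxt (v ++ c ∷ []) ≡ stdAux seen nxt v ++ stdNext seen nxt v ∷ []
stdAux-snoc seen nxt [] c (inj₁ c∈seen) rewrite c∈seen = refl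
stdAux-snoc seen nxt (a ∷ v) c occ with memb a seen in a∈seen
... | true = cong (nxt ∷_) (stdAux-snoc seen (suc nxt) v c (occurs-skip c a seen v a∈seen occ))
... | false = cong (a ∷_) (stdAux-snoc (a ∷ seen) nxt v c (occurs-record c a seen v occ))

stdNext-≥ : ∀ seen nxt v → nxt ≤ stdNext seen nxt v
stdNext-≥ seen nxt [] = ℕP.≤-refl
stdNext-≥ seen nxt (a ∷ v) with memb a seen
... | true = ℕP.≤-trans (ℕP.n≤1+n nxt) (stdNext-≥ seen (suc nxt) v)
... | false = stdNext-≥ (a ∷ seen) nxt v

stdAux-bounded : ∀ seen nxt v → All (_< nxt) v → All (_< stdNext seen nxt v) (stdAux seen nxt v)
stdAux-bounded seen nxt [] [] = []
stdAux-bounded seen nxt (a ∷ v) (a<nxt ∷ v<nxt) with memb a seen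
... | true = ℕP.<-≤-trans (ℕP.n<1+n nxt) (stdNext-≥ seen (suc nxt) v)
             ∷ stdAux-bounded seen (suc nxt) v (All.map ℕP.m<n⇒m<1+n v<nxt)
... | false = ℕP.<-≤-trans a<nxt (stdNext-≥ (a ∷ seen) nxt v) ∷ stdAux-bounded (a ∷ seen) nxt v v<nxt

filterᵇ-none : ∀ (p : ℕ → Bool) l → All (λ b → p b ≡ false) l → filterᵇ p l ≡ []
filterᵇ-none p l none = LP.filter-none (T? ∘ p) (All.map (λ pb≡false → subst T pb≡false) none)

std-covering : ∀ k v → (∀ b → 1 ≤ b → b ≤ k → memb b v ≡ true) → std k v ≡ stdAux [] (suc k) v
std-covering k v covers =
  trans (cong (stdAux [] (suc k) v ++_)
              (filterᵇ-none _ (oneTo k) (All.map (λ (1≤b , b≤k) → cong not (covers _ 1≤b b≤k)) (oneTo-bounds k))))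
        (LP.++-identityʳ _)

std-snoc : ∀ k v a → (∀ b → 1 ≤ b → b ≤ k → memb b v ≡ true) → memb a v ≡ true →
           std k (v ++ a ∷ []) ≡ stdAux [] (suc k) v ++ stdNext [] (suc k) v ∷ []
std-snoc k v a covers a∈v =
  trans (std-covering k (v ++ a ∷ []) (λ b 1≤b b≤k → memb-++ˡ b v (a ∷ []) (covers b 1≤b b≤k)))
        (stdAux-snoc [] (suc k) v a (inj₂ a∈v))

length-concatMap : ∀ (f : ℕ → List ℕ) L → length (concatMap f L) ≡ sum (map (length ∘ f) L)
length-concatMap f [] = refl
length-concatMap f (b ∷ L) = trans (LP.length-++ (f b)) (cong (length (f b) +_) (length-concatMap f L))

length-positions : ∀ b w → length (positions b w) ≡ count b w
length-positions b w =
  trans (LP.length-map proj₁ (filterᵇ at-b (zip (oneTo (length w)) w))) (indexed (oneTo (length w)) w (length-oneTo _))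
  where
  at-b : ℕ × ℕ → Bool
  at-b t = b ≡ᵇ proj₂ t
  indexed : ∀ (is l : List ℕ) → length is ≡ length l → length (filterᵇ at-b (zip is l)) ≡ count b l
  indexed [] [] _ = refl
  indexed (i ∷ is) (c ∷ l) eq rewrite length-filterᵇ-∷ at-b (i , c) (zip is l) | count-∷ b c l
    = cong (λ n → if b ≡ᵇ c then suc n else n) (indexed is l (ℕP.suc-injective eq))

+-exchange : ∀ m n o → m + (n + o) ≡ n + (m + o)
+-exchange = solve-∀

sum-count-∷ : ∀ L x w → sum (map (λ b → count b (x ∷ w)) L) ≡ count x L + sum (map (λ b → count b w) L)
sum-count-∷ [] x w = refl
sum-count-∷ (b ∷ L) x w
  rewrite count-∷ b x w | count-∷ x b L | ≡ᵇ-sym b x | sum-count-∷ L x w with x ≡ᵇ b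
... | true = cong suc (+-exchange (count b w) (count x L) _)
... | false = +-exchange (count b w) (count x L) _

sum-zero : ∀ {A : Set} (L : List A) → sum (map (λ _ → 0) L) ≡ 0
sum-zero [] = refl
sum-zero (_ ∷ L) = sum-zero L

sum-count : ∀ w L → (∀ x → memb x w ≡ true → count x L ≡ 1) → sum (map (λ b → count b w) L) ≡ length w
sum-count [] L _ = sum-zero L
sum-count (x ∷ w) L once =
  trans (sum-count-∷ L x w)
        (cong₂ _+_ (once x (memb-here x w)) (sum-count w L (λ y y∈w → once y (memb-there y x w y∈w))))

length-sigma : ∀ w → length (sigma w) ≡ length w
length-sigma w =
  trans (length-concatMap (λ b → positions b w) (initLetters w))
        (trans (cong sum (LP.map-cong (λ b → length-positions b w) (initLetters w)))
               (sum-count w (initLetters w) (λ x x∈w → trans (count-initLetters [] w x) (if-cong x∈w))))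

All-positions : ∀ {P : ℕ → Set} (q : ℕ × ℕ → Bool) (is l : List ℕ) → All P is →
                All P (map proj₁ (filterᵇ q (zip is l)))
All-positions q [] l _ = []
All-positions q (i ∷ is) [] _ = []
All-positions q (i ∷ is) (c ∷ l) (pi ∷ pis) with q (i , c)
... | true = pi ∷ All-positions q is l pis
... | false = All-positions q is l pis

sigma-bounded : ∀ w → All (_≤ length w) (sigma w)
sigma-bounded w = AP.concat⁺ (AP.map⁺ (All.universal positions-bounded (initLetters w)))
  where
  positions-bounded : ∀ b → All (_≤ length w) (positions b w)
  positions-bounded b = All-positions _ (oneTo (length w)) w (All.map proj₂ (oneTo-bounds (length w)))

posOf-snoc-≢ : ∀ j σ c → (c ≡ᵇ j) ≡ false → posOf j (σ ++ c ∷ []) ≡ posOf j σ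
posOf-snoc-≢ j [] c c≢j rewrite c≢j = refl
posOf-snoc-≢ j (a ∷ σ) c c≢j rewrite posOf-snoc-≢ j σ c c≢j = refl

posOf-snoc-new : ∀ j σ → All (λ x → (x ≡ᵇ j) ≡ false) σ → posOf j (σ ++ j ∷ []) ≡ suc (length σ)
posOf-snoc-new j [] [] rewrite ≡ᵇ-refl j = refl
posOf-snoc-new j (a ∷ σ) (a≢j ∷ σ≢j) rewrite a≢j | posOf-snoc-new j σ σ≢j = refl

≤⇒≢suc : ∀ {x n} → x ≤ n → x ≢ suc n
≤⇒≢suc x≤n refl = ℕP.<-irrefl refl x≤n

length-permInv : ∀ σ → length (permInv σ) ≡ length σ
length-permInv σ = trans (LP.length-map _ (oneTo (length σ))) (length-oneTo (length σ))

permInv-snoc : ∀ σ n → length σ ≡ n → All (_≤ n) σ → permInv (σ ++ suc n ∷ []) ≡ permInv σ ++ suc n ∷ []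
permInv-snoc σ n refl σ≤n = begin
    map (λ j → posOf j (σ ++ suc n ∷ [])) (oneTo (length (σ ++ suc n ∷ [])))
  ≡⟨ cong (λ m → map (λ j → posOf j (σ ++ suc n ∷ [])) (oneTo m)) (trans (LP.length-++ σ) (ℕP.+-comm n 1)) ⟩
    map (λ j → posOf j (σ ++ suc n ∷ [])) (oneTo (suc n))
  ≡⟨ cong (map (λ j → posOf j (σ ++ suc n ∷ []))) (oneTo-suc n) ⟩
    map (λ j → posOf j (σ ++ suc n ∷ [])) (oneTo n ++ suc n ∷ [])
  ≡⟨ LP.map-++ (λ j → posOf j (σ ++ suc n ∷ [])) (oneTo n) (suc n ∷ []) ⟩
    map (λ j → posOf j (σ ++ suc n ∷ [])) (oneTo n) ++ posOf (suc n) (σ ++ suc n ∷ []) ∷ []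
  ≡⟨ cong₂ (λ u v → u ++ v ∷ []) (LP.map-cong-local (All.map old-position (oneTo-bounds n)))
                                  (posOf-snoc-new (suc n) σ (All.map new-letter σ≤n)) ⟩
    permInv σ ++ suc n ∷ []
  ∎
  where
  open ≡-Reasoning
  old-position : ∀ {j} → 1 ≤ j × j ≤ n → posOf j (σ ++ suc n ∷ []) ≡ posOf j σ
  old-position {j} (_ , j≤n) = posOf-snoc-≢ j σ (suc n) (≢⇒≡ᵇ-false (suc n) j (≤⇒≢suc j≤n ∘ sym))
  new-letter : ∀ {x} → x ≤ n → (x ≡ᵇ suc n) ≡ false
  new-letter {x} x≤n = ≢⇒≡ᵇ-false x (suc n) (≤⇒≢suc x≤n)

nth-++ˡ : ∀ (π l : List ℕ) i → i < length π → nth (π ++ l) i ≡ nth π i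
nth-++ˡ (x ∷ π) l zero _ = refl
nth-++ˡ (x ∷ π) l (suc i) (s≤s i<π) = nth-++ˡ π l i i<π

nth-++-length : ∀ (π : List ℕ) x l → nth (π ++ x ∷ l) (length π) ≡ x
nth-++-length [] x l = refl
nth-++-length (y ∷ π) x l = nth-++-length π x l

permApp-snoc : ∀ π n → length π ≡ n → ∀ i → permApp (π ++ suc n ∷ []) i ≡ permApp π i
permApp-snoc π _ refl zero = refl
permApp-snoc π _ refl (suc i) rewrite LP.length-++ π {suc (length π) ∷ []} | ℕP.+-comm (length π) 1
  with ℕP.<-cmp i (length π)
... | tri< i<π _ _ rewrite <⇒<ᵇ-true i<π | <⇒<ᵇ-true (ℕP.m<n⇒m<1+n i<π)
  = nth-++ˡ π (suc (length π) ∷ []) i i<π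
... | tri≈ _ refl _ rewrite <⇒<ᵇ-true (ℕP.n<1+n (length π)) | ≤⇒<ᵇ-false (ℕP.≤-refl {length π})
  = nth-++-length π (suc (length π)) []
... | tri> _ _ π<i rewrite ≤⇒<ᵇ-false {i} {suc (length π)} π<i | ≤⇒<ᵇ-false (ℕP.<⇒≤ π<i) = refl

theorem7p1 : (n k : ℕ) → 1 ≤ k → k ≤ n → (w : List ℕ) → InW n k w →
    schubWord k (appendLastInit w) ≈ₚ schubWord k w
theorem7p1 n k 1≤k _ [] (_ , _ , covers) with () ← covers 1 ℕP.≤-refl 1≤k
theorem7p1 n k _ _ (x ∷ w) (_ , letters , covers) m = cong (λ p → coeff p m) (begin
    act (permInv (sigma (u ++ a ∷ []))) (schub (std k (conv (u ++ a ∷ []))))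
  ≡⟨ cong₂ (λ σ′ v′ → act (permInv σ′) (schub (std k v′))) (sigma-snoc last) (conv-snoc last) ⟩
    act (permInv (σ ++ suc (length u) ∷ [])) (schub (std k (v ++ a ∷ [])))
  ≡⟨ cong₂ (λ π ρ → act π (schub ρ)) (permInv-snoc σ (length u) (length-sigma u) (sigma-bounded u))
                                      (std-snoc k v a covers-v (memb-conv a u (LastInitial.occurs last))) ⟩
    act (τ ++ suc (length u) ∷ []) (schub (X ++ stdNext [] (suc k) v ∷ []))
  ≡⟨ act-cong (τ ++ suc (length u) ∷ []) τ (permApp-snoc τ (length u) (trans (length-permInv σ) (length-sigma u)))
              (schub-++-max _ X (stdAux-bounded [] (suc k) v v≤k)) ⟩
    act τ (schub X)
  ≡⟨ cong (act τ ∘ schub) (sym (std-covering k v covers-v)) ⟩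
    schubWord k u
  ∎)
  where
  open ≡-Reasoning
  u = x ∷ w
  a = lastOr 0 (initLetters u)
  last = lastInitial x w
  σ = sigma u
  τ = permInv σ
  v = conv u
  X = stdAux [] (suc k) v
  v≤k : All (_< suc k) v
  v≤k = All-conv u (All.map (λ (_ , b≤k) → s≤s b≤k) letters)
  covers-v : ∀ b → 1 ≤ b → b ≤ k → memb b v ≡ true
  covers-v b 1≤b b≤k = memb-conv b u (∈⇒memb (covers b 1≤b b≤k))
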